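{- Let $A$ be a non-duplicated genome and $B$ a duplicated genome. For any BD-DCJ (resp. BD-reversal) scenario between $A$ and $B$, there exists a DCJ (resp. reversal) scenario of the same length between a dedoubled genome $D$ and $B$ such that the reduction of $D$ is $A$ ($D^R=A$).
   Context: Genomes: chromosomes are linear $(\circ~x_1\cdots x_m~\circ)$ ($\circ$ = telomere) or circular sequences of signed markers; reading backwards reverses order and negates signs. Paralogous copies are written $x,\bar{x}$ ($\bar{\bar{x}}=x$). A non-duplicated genome has every marker once; a duplicated genome has some markers in two copies. An adjacency is a pair of consecutive entries, $(x~y)$ identified with $(-y~-x)$. A DCJ operation cuts two adjacencies and rejoins the four exposed extremities differently, forming two new adjacencies; a reversal is a DCJ replacing a segment of a chromosome by the segment read backwards. A 1-breakpoint-duplication DCJ on adjacencies $(a~b)$ and $(c~d)$ first inserts $\bar{a}$ to produce $(a~\bar{a}~b)$, then applies a DCJ cutting $(a~\bar{a})$ and $(c~d)$ to produce either $(a~d),(c~\bar{a})$ or $(a~-c),(-\bar{a}~d)$. A 2-breakpoint-duplication DCJ on $(a~b)$, $(c~d)$ first inserts $\bar{a}$ and $\bar{c}$ producing $(a~\bar{a}~b)$ and $(c~\bar{c}~d)$, then applies a DCJ cutting $(a~\bar{a})$ and $(c~\bar{c})$ to produce either $(a~\bar{c}),(c~\bar{a})$ or $(a~-c),(-\bar{a}~\bar{c})$. A BD-DCJ is a DCJ, a 1-breakpoint-duplication DCJ or a 2-breakpoint-duplication DCJ; a BD-reversal is a BD-DCJ whose DCJ step is a reversal. A BD-DCJ (resp.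 BD-reversal) scenario between $A$ and $B$ is a sequence of such operations transforming $A$ into $B$. A dedoubled genome is a duplicated genome in which, for every duplicated marker $x$, $(x~\bar{x})$ or $(\bar{x}~x)$ is an adjacency; its reduction $D^R$ is the non-duplicated genome obtained by deleting the copy $\bar{x}$ of every duplicated marker $x$. -}

module Defs where

open import Data.Bool using (Bool; true; false; not; if_then_else_)
open import Data.Nat using (ℕ; zero; suc; _+_; _*_; _⊓_; _⊔_)
open import Data.Product using (_×_; _,_; Σ; ∃; ∃-syntax)
open import Data.Sum using (_⊎_)
open import Data.List using (List; []; _∷_; _++_; map; reverse; concatMap)
open import Data.List.Membership.Propositional using (_∈_)
open import Data.List.Relation.Unary.All using (All)
open import Data.List.Relation.Unary.Unique.Propositional using (Unique)
open import Data.List.Relation.Binary.Permutation.Propositional using (_↭_)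
open import Relation.Binary.PropositionalEquality using (_≡_)
open import Relation.Nullary using (¬_)

-- An entry of a chromosome: a signed occurrence of marker `name`;
-- `barred = false` is the copy x, `barred = true` the paralogous copy x̄.
record Entry : Set where
  constructor mkEntry
  field
    positive : Bool
    name     : ℕ
    barred   : Bool
open Entry public

negEntry : Entry → Entry
negEntry (mkEntry s n b) = mkEntry (not s) n b

barEntry : Entry → Entry
barEntry (mkEntry s n b) = mkEntry s n (not b)

data Chromosome : Set where
  lin  : List Entry → Chromosome
  circ : List Entry → Chromosome

Genome : Set
Genome = List Chromosome

entriesC : Chromosome → List Entry
entriesC (lin xs)  = xs
entriesC (circ xs) = xs

entries : Genome → List Entry
entries = concatMap entriesC

Occurs : ℕ → Bool → Genome → Set
Occurs n b G = ∃[ e ] (e ∈ entries G × name e ≡ n × barred e ≡ b)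

-- tel = telomere ∘ ; ext n b h = head (h = true) / tail of copy b of marker n
data Point : Set where
  tel : Point
  ext : ℕ → Bool → Bool → Point

data Elt : Set where
  ∘   : Elt
  ⟨_⟩ : Entry → Elt

negElt : Elt → Elt
negElt ∘     = ∘
negElt ⟨ e ⟩ = ⟨ negEntry e ⟩

leftPt : Elt → Point
leftPt ∘     = tel
leftPt ⟨ e ⟩ = ext (name e) (barred e) (not (positive e))

rightPt : Elt → Point
rightPt ∘     = tel
rightPt ⟨ e ⟩ = ext (name e) (barred e) (positive e)

Adj : Set
Adj = Point × Point

-- the adjacency (x y); note adj x y and adj (negElt y) (negElt x)
-- consist of the same two points, and are identified below
adj : Elt → Elt → Adj
adj x y = rightPt x , leftPt y

pairs : List Elt → List Adj
pairs (x ∷ y ∷ r) = adj x y ∷ pairs (y ∷ r)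
pairs _           = []

adjsC : Chromosome → List Adj
adjsC (lin xs)        = pairs (∘ ∷ map ⟨_⟩ xs ++ ∘ ∷ [])
adjsC (circ [])       = []
adjsC (circ (x ∷ xs)) = pairs (map ⟨_⟩ (x ∷ xs) ++ ⟨ x ⟩ ∷ [])

adjs : Genome → List Adj
adjs = concatMap adjsC

-- canonical (unordered) form of adjacencies: injective numeric code of
-- points, pair sorted; the empty adjacency (∘ ∘) is discarded
bit : Bool → ℕ
bit b = if b then 1 else 0

code : Point → ℕ
code tel         = 0
code (ext n b h) = suc (4 * n + 2 * bit b + bit h)

cadj : Adj → ℕ × ℕ
cadj (p , q) = code p ⊓ code q , code p ⊔ code q

canon : List Adj → List (ℕ × ℕ)
canon []                 = []
canon ((tel , tel) ∷ xs) = canon xs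
canon (p ∷ xs)           = cadj p ∷ canon xs

_hasAdjs_ : Genome → List Adj → Set
G hasAdjs xs = canon (adjs G) ↭ canon xs

-- genome equality: same multiset of adjacencies
_≈_ : Genome → Genome → Set
G ≈ H = canon (adjs G) ↭ canon (adjs H)

NonDuplicated : Genome → Set
NonDuplicated A = Unique (map name (entries A)) × All (λ e → barred e ≡ false) (entries A)

key : Entry → ℕ × Bool
key e = name e , barred e

Duplicated : Genome → Set
Duplicated B = Unique (map key (entries B))
             × All (λ e → barred e ≡ true → Occurs (name e) false B) (entries B)

HasAdj : Genome → Elt → Elt → Set
HasAdj G x y = cadj (adj x y) ∈ canon (adjs G)

Dedoubled : Genome → Set
Dedoubled D = Duplicated D
  × (∀ n → Occurs n false D → Occurs n true D →
       HasAdj D ⟨ mkEntry true n false ⟩ ⟨ mkEntry true n true ⟩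
     ⊎ HasAdj D ⟨ mkEntry true n true ⟩ ⟨ mkEntry true n false ⟩)

dropBarred : List Entry → List Entry
dropBarred [] = []
dropBarred (e ∷ es) = if barred e then dropBarred es else e ∷ dropBarred es

reduceC : Chromosome → Chromosome
reduceC (lin xs)  = lin (dropBarred xs)
reduceC (circ xs) = circ (dropBarred xs)

reduction : Genome → Genome
reduction = map reduceC

data DCJ (G H : Genome) : Set where
  dcj₁ : (a b c d : Elt) (rest : List Adj) →
         G hasAdjs (adj a b ∷ adj c d ∷ rest) →
         H hasAdjs (adj a d ∷ adj c b ∷ rest) →
         ¬ (canon (adj a b ∷ adj c d ∷ []) ↭ canon (adj a d ∷ adj c b ∷ [])) →
         DCJ G H
  dcj₂ : (a b c d : Elt) (rest : List Adj) →
         G hasAdjs (adj a b ∷ adj c d ∷ rest) →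
         H hasAdjs (adj a (negElt c) ∷ adj (negElt b) d ∷ rest) →
         ¬ (canon (adj a b ∷ adj c d ∷ []) ↭ canon (adj a (negElt c) ∷ adj (negElt b) d ∷ [])) →
         DCJ G H

revNeg : List Entry → List Entry
revNeg xs = reverse (map negEntry xs)

data SegRev : Chromosome → Chromosome → Set where
  linRev  : (u s v : List Entry) → SegRev (lin (u ++ s ++ v)) (lin (u ++ revNeg s ++ v))
  circRev : (u s v : List Entry) → SegRev (circ (u ++ s ++ v)) (circ (u ++ revNeg s ++ v))

Reversal : Genome → Genome → Set
Reversal G H = DCJ G H
  × (∃[ c ] ∃[ c' ] ∃[ rest ] (SegRev c c' × G ≈ (c ∷ rest) × H ≈ (c' ∷ rest)))

data Model : Set where
  dcjModel revModel : Model

Op : Model → Genome → Genome → Set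
Op dcjModel = DCJ
Op revModel = Reversal

-- 1-breakpoint-duplication on (a b),(c d): G' is G with ā inserted,
-- then the DCJ step G' → H (required to be an `Op` step) cuts (a ā),(c d)
data BD1 (Step : Genome → Genome → Set) (G H : Genome) : Set where
  bd1 : (a : Entry) (b c d : Elt) (rest : List Adj) (G' : Genome) →
        ¬ Occurs (name a) (not (barred a)) G →
        G hasAdjs (adj ⟨ a ⟩ b ∷ adj c d ∷ rest) →
        G' hasAdjs (adj ⟨ a ⟩ ⟨ barEntry a ⟩ ∷ adj ⟨ barEntry a ⟩ b ∷ adj c d ∷ rest) →
        (H hasAdjs (adj ⟨ a ⟩ d ∷ adj c ⟨ barEntry a ⟩ ∷ adj ⟨ barEntry a ⟩ b ∷ rest)
         ⊎ H hasAdjs (adj ⟨ a ⟩ (negElt c) ∷ adj (negElt ⟨ barEntry a ⟩) d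
                        ∷ adj ⟨ barEntry a ⟩ b ∷ rest)) →
        Step G' H →
        BD1 Step G H

-- 2-breakpoint-duplication on (a b),(c d): G' is G with ā and c̄ inserted,
-- then the DCJ step G' → H cuts (a ā),(c c̄)
data BD2 (Step : Genome → Genome → Set) (G H : Genome) : Set where
  bd2 : (a : Entry) (b : Elt) (c : Entry) (d : Elt) (rest : List Adj) (G' : Genome) →
        ¬ Occurs (name a) (not (barred a)) G →
        ¬ Occurs (name c) (not (barred c)) G →
        ¬ (key a ≡ key c) →
        G hasAdjs (adj ⟨ a ⟩ b ∷ adj ⟨ c ⟩ d ∷ rest) →
        G' hasAdjs (adj ⟨ a ⟩ ⟨ barEntry a ⟩ ∷ adj ⟨ barEntry a ⟩ b
                    ∷ adj ⟨ c ⟩ ⟨ barEntry c ⟩ ∷ adj ⟨ barEntry c ⟩ d ∷ rest) →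
        (H hasAdjs (adj ⟨ a ⟩ ⟨ barEntry c ⟩ ∷ adj ⟨ c ⟩ ⟨ barEntry a ⟩
                    ∷ adj ⟨ barEntry a ⟩ b ∷ adj ⟨ barEntry c ⟩ d ∷ rest)
         ⊎ H hasAdjs (adj ⟨ a ⟩ (negElt ⟨ c ⟩) ∷ adj (negElt ⟨ barEntry a ⟩) ⟨ barEntry c ⟩
                      ∷ adj ⟨ barEntry a ⟩ b ∷ adj ⟨ barEntry c ⟩ d ∷ rest)) →
        Step G' H →
        BD2 Step G H

BDStep : (Genome → Genome → Set) → Genome → Genome → Set
BDStep Step G H = Step G H ⊎ BD1 Step G H ⊎ BD2 Step G H

data Scenario (Step : Genome → Genome → Set) : ℕ → Genome → Genome → Set where
  done : ∀ {G H} → G ≈ H → Scenario Step zero G H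
  step : ∀ {n G G' H} → Step G G' → Scenario Step n G' H → Scenario Step (suc n) G H

module Submission where

-- Glue in advance, next to each marker x of A, the copy x̄ that the scenario will create at
-- an extremity of x: D = glue P A for a set P of extremities of A. Gluing at P keeps every
-- adjacency of a genome G, with each extremity p ∈ P of a marker x replaced by the same
-- extremity of x̄, and adds the adjacencies (x x̄). If P has at most one extremity per
-- marker and no p ∈ P has its x̄-twin already in G, this relabelling of extremities is
-- injective, so every DCJ (or reversal) G → H lifts to one from glue P G to glue P H. The
-- duplicating half of a BD operation inserts ā right after a, which is exactly gluing at the
-- right extremity of a, so it is absorbed into P (a 2-breakpoint duplication being two such
-- insertions). P is built backwards along the scenario, and D reduces to A because gluing
-- only adds copies x̄.

open import Defs
open import Data.Nat using (ℕ)
open import Data.Product using (Σ; _×_)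

open import Data.Bool using (Bool; true; false; not; if_then_else_; _∨_)
open import Data.Bool.Properties using (not-involutive; not-injective; ∨-assoc)
open import Data.Nat using (zero; suc; _+_; _*_; _≤?_)
import Data.Nat.Properties as ℕ
open import Data.Product using (_,_; proj₁; proj₂; ∃-syntax)
open import Data.Sum as Sum using (_⊎_; inj₁; inj₂)
open import Data.Empty using (⊥-elim)
open import Data.List using (List; []; _∷_; [_]; _++_; map; reverse; concatMap)
import Data.List.Properties as List
open import Data.List.Relation.Unary.All as All using (All; []; _∷_)
open import Data.List.Relation.Unary.All.Properties using (¬Any⇒All¬; ++⁻ˡ; ++⁻ʳ)
open import Data.List.Relation.Unary.AllPairs using ([]; _∷_)
open import Data.List.Relation.Unary.Any using (here; there)
open import Data.List.Relation.Unary.Unique.Propositional using (Unique)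
open import Data.List.Relation.Unary.Unique.Propositional.Properties using (Unique[x∷xs]⇒x∉xs)
  renaming (++⁺ to Unique-++⁺)
open import Data.List.Relation.Binary.Disjoint.Propositional using (Disjoint)
import Data.List.Relation.Binary.Permutation.Setoid.Properties as ↭ₛ
open import Data.List.Membership.Propositional using (_∈_; _∉_; find; lose)
open import Data.List.Membership.Propositional.Properties
  using (∈-++⁺ˡ; ∈-++⁺ʳ; ∈-map⁺; ∈-map⁻; ∈-concatMap⁺; ∈-concatMap⁻)
open import Data.List.Relation.Binary.Permutation.Propositional
  using (_↭_; ↭-refl; ↭-sym; ↭-trans; ↭-reflexive; prep; swap; ↭⇒↭ₛ; module PermutationReasoning)
  renaming (refl to ↭-[]; trans to ↭-∘)
open import Data.List.Relation.Binary.Permutation.Propositional.Properties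
  using (++⁺ˡ; ++⁺ʳ; ++⁺; shifts; ++-comm; map⁺; ∈-resp-↭)
open import Relation.Binary.Definitions using (DecidableEquality)
open import Relation.Binary.PropositionalEquality
  using (_≡_; _≢_; refl; sym; trans; cong; cong₂; subst; setoid; module ≡-Reasoning)
open import Relation.Nullary using (¬_; yes; no; does)
import Relation.Nullary.Decidable as Dec
open import Function using (_∘′_)

private
  variable
    S T U : Set

concatMap⁺ : (f : S → List T) {xs ys : List S} → xs ↭ ys → concatMap f xs ↭ concatMap f ys
concatMap⁺ f ↭-[]         = ↭-refl
concatMap⁺ f (prep x p)   = ++⁺ˡ (f x) (concatMap⁺ f p)
concatMap⁺ f (swap x y p) = ↭-trans (shifts (f x) (f y)) (++⁺ˡ (f y) (++⁺ˡ (f x) (concatMap⁺ f p)))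
concatMap⁺ f (↭-∘ p q)    = ↭-trans (concatMap⁺ f p) (concatMap⁺ f q)

concatMap-cong-↭ : {f g : S → List T} → (∀ x → f x ↭ g x) → ∀ xs → concatMap f xs ↭ concatMap g xs
concatMap-cong-↭ f↭g []       = ↭-refl
concatMap-cong-↭ f↭g (x ∷ xs) = ++⁺ (f↭g x) (concatMap-cong-↭ f↭g xs)

concatMap-concatMap : (f : T → List U) (g : S → List T) (xs : List S) →
                      concatMap f (concatMap g xs) ≡ concatMap (concatMap f ∘′ g) xs
concatMap-concatMap f g []       = refl
concatMap-concatMap f g (x ∷ xs) =
  trans (List.concatMap-++ f (g x) (concatMap g xs)) (cong (concatMap f (g x) ++_) (concatMap-concatMap f g xs))

concatMap-++-++ : (f : S → List T) (xs ys zs : List S) →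
                  concatMap f (xs ++ ys ++ zs) ≡ concatMap f xs ++ concatMap f ys ++ concatMap f zs
concatMap-++-++ f xs ys zs =
  trans (List.concatMap-++ f xs (ys ++ zs)) (cong (concatMap f xs ++_) (List.concatMap-++ f ys zs))

Unique-resp-↭ : {xs ys : List S} → xs ↭ ys → Unique xs → Unique ys
Unique-resp-↭ p = ↭ₛ.Unique-resp-↭ (setoid _) (↭⇒↭ₛ p)

∈-concatMap⁺′ : (f : S → List T) {xs : List S} {x : S} {y : T} → x ∈ xs → y ∈ f x → y ∈ concatMap f xs
∈-concatMap⁺′ f x∈xs y∈fx = ∈-concatMap⁺ f (lose x∈xs y∈fx)

++-interchange-↭ : (ws xs ys zs : List S) → (ws ++ xs) ++ (ys ++ zs) ↭ (ws ++ ys) ++ (xs ++ zs)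
++-interchange-↭ ws xs ys zs = begin
  (ws ++ xs) ++ (ys ++ zs) ≡⟨ List.++-assoc ws xs (ys ++ zs) ⟩
  ws ++ xs ++ ys ++ zs     ↭⟨ ++⁺ˡ ws (shifts xs ys) ⟩
  ws ++ ys ++ xs ++ zs     ≡⟨ List.++-assoc ws ys (xs ++ zs) ⟨
  (ws ++ ys) ++ (xs ++ zs) ∎
  where open PermutationReasoning

[_if_] : S → Bool → List S
[ x if true ]  = [ x ]
[ x if false ] = []

nextMarker : Point → Point
nextMarker tel         = tel
nextMarker (ext n b h) = ext (suc n) b h

decode′ : ℕ → Point
decode′ 0                         = ext 0 false false
decode′ 1                         = ext 0 false true
decode′ 2                         = ext 0 true false
decode′ 3                         = ext 0 true true
decode′ (suc (suc (suc (suc k)))) = nextMarker (decode′ k)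

decode : ℕ → Point
decode zero    = tel
decode (suc k) = decode′ k

decode-code : ∀ p → decode (code p) ≡ p
decode-code tel         = refl
decode-code (ext n b h) = go n b h
  where
    go : ∀ n b h → decode′ (4 * n + 2 * bit b + bit h) ≡ ext n b h
    go zero    false false = refl
    go zero    false true  = refl
    go zero    true  false = refl
    go zero    true  true  = refl
    go (suc n) b     h     =
      trans (cong (λ k → decode′ (k + 2 * bit b + bit h)) (ℕ.*-suc 4 n)) (cong nextMarker (go n b h))

code-injective : ∀ {p q} → code p ≡ code q → p ≡ q
code-injective {p} {q} eq = trans (sym (decode-code p)) (trans (cong decode eq) (decode-code q))

_≟ᴾ_ : DecidableEquality Point
p ≟ᴾ q = Dec.map′ code-injective (cong code) (code p ℕ.≟ code q)

open import Data.List.Membership.DecPropositional _≟ᴾ_ using (_∈?_)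

_∈ᵇ_ : Point → List Point → Bool
p ∈ᵇ P = does (p ∈? P)

∈ᵇ-++ : ∀ p Q R → p ∈ᵇ (Q ++ R) ≡ p ∈ᵇ Q ∨ p ∈ᵇ R
∈ᵇ-++ p []      R = refl
∈ᵇ-++ p (q ∷ Q) R rewrite ∈ᵇ-++ p Q R = sym (∨-assoc (does (p ≟ᴾ q)) (p ∈ᵇ Q) (p ∈ᵇ R))

canon₁ : Adj → List (ℕ × ℕ)
canon₁ (tel , tel) = []
canon₁ a           = [ cadj a ]

canon≡concatMap : ∀ xs → canon xs ≡ concatMap canon₁ xs
canon≡concatMap []                          = refl
canon≡concatMap ((tel , tel) ∷ xs)          = canon≡concatMap xs
canon≡concatMap ((tel , ext n b h) ∷ xs)    = cong (_ ∷_) (canon≡concatMap xs)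
canon≡concatMap ((ext n b h , q) ∷ xs)      = cong (_ ∷_) (canon≡concatMap xs)

canon-↭ : ∀ {xs ys} → xs ↭ ys → canon xs ↭ canon ys
canon-↭ {xs} {ys} p rewrite canon≡concatMap xs | canon≡concatMap ys = concatMap⁺ canon₁ p

canon-++ : ∀ xs ys → canon (xs ++ ys) ≡ canon xs ++ canon ys
canon-++ xs ys rewrite canon≡concatMap (xs ++ ys) | canon≡concatMap xs | canon≡concatMap ys =
  List.concatMap-++ canon₁ xs ys

cadj-comm : ∀ p q → cadj (p , q) ≡ cadj (q , p)
cadj-comm p q = cong₂ _,_ (ℕ.⊓-comm (code p) (code q)) (ℕ.⊔-comm (code p) (code q))

cadj-ordered : ∀ p q → cadj (p , q) ≡ (code p , code q) ⊎ cadj (p , q) ≡ (code q , code p)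
cadj-ordered p q with code p ≤? code q
... | yes p≤q = inj₁ (cong₂ _,_ (ℕ.m≤n⇒m⊓n≡m p≤q) (ℕ.m≤n⇒m⊔n≡n p≤q))
... | no p≰q  = let q≤p = ℕ.≰⇒≥ p≰q in inj₂ (cong₂ _,_ (ℕ.m≥n⇒m⊓n≡n q≤p) (ℕ.m≥n⇒m⊔n≡m q≤p))

-- A relabelling gives the new copy bit of the extremity `ext n b h`.
Relabelling : Set
Relabelling = ℕ → Bool → Bool → Bool

relabel : Relabelling → Point → Point
relabel φ tel         = tel
relabel φ (ext n b h) = ext n (φ n b h) h

relabelAdj : Relabelling → Adj → Adj
relabelAdj φ (p , q) = relabel φ p , relabel φ q

relabelCode : Relabelling → ℕ × ℕ → ℕ × ℕ
relabelCode φ (x , y) = cadj (relabel φ (decode x) , relabel φ (decode y))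

relabelCode-cadj : ∀ φ p q → relabelCode φ (cadj (p , q)) ≡ cadj (relabelAdj φ (p , q))
relabelCode-cadj φ p q = go (cadj (p , q)) (cadj-ordered p q)
  where
    go : ∀ c → c ≡ (code p , code q) ⊎ c ≡ (code q , code p) →
         relabelCode φ c ≡ cadj (relabelAdj φ (p , q))
    go _ (inj₁ refl) rewrite decode-code p | decode-code q = refl
    go _ (inj₂ refl) rewrite decode-code p | decode-code q = cadj-comm (relabel φ q) (relabel φ p)

canon₁-relabelAdj : ∀ φ a → canon₁ (relabelAdj φ a) ≡ map (relabelCode φ) (canon₁ a)
canon₁-relabelAdj φ (tel , tel)         = refl
canon₁-relabelAdj φ (tel , ext n b h)   = cong [_] (sym (relabelCode-cadj φ tel (ext n b h)))
canon₁-relabelAdj φ (ext n b h , q)     = cong [_] (sym (relabelCode-cadj φ (ext n b h) q))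

canon-relabelAdj : ∀ φ xs → canon (map (relabelAdj φ) xs) ≡ map (relabelCode φ) (canon xs)
canon-relabelAdj φ xs = begin
  canon (map (relabelAdj φ) xs)                          ≡⟨ canon≡concatMap (map (relabelAdj φ) xs) ⟩
  concatMap canon₁ (map (relabelAdj φ) xs)               ≡⟨ List.concatMap-map canon₁ (relabelAdj φ) xs ⟩
  concatMap (canon₁ ∘′ relabelAdj φ) xs                  ≡⟨ List.concatMap-cong (canon₁-relabelAdj φ) xs ⟩
  concatMap (map (relabelCode φ) ∘′ canon₁) xs           ≡⟨ List.map-concatMap (relabelCode φ) canon₁ xs ⟨
  map (relabelCode φ) (concatMap canon₁ xs)              ≡⟨ cong (map (relabelCode φ)) (canon≡concatMap xs) ⟨
  map (relabelCode φ) (canon xs)                         ∎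
  where open ≡-Reasoning

canon-relabelAdj-↭ : ∀ φ {xs ys} → canon xs ↭ canon ys →
                     canon (map (relabelAdj φ) xs) ↭ canon (map (relabelAdj φ) ys)
canon-relabelAdj-↭ φ {xs} {ys} p rewrite canon-relabelAdj φ xs | canon-relabelAdj φ ys = map⁺ (relabelCode φ) p

leftExt rightExt : Entry → Point
leftExt e  = leftPt ⟨ e ⟩
rightExt e = rightPt ⟨ e ⟩

leftExt≢rightExt : ∀ e → leftExt e ≢ rightExt e
leftExt≢rightExt (mkEntry true  n b) ()
leftExt≢rightExt (mkEntry false n b) ()

extremities : List Entry → List Point
extremities = concatMap (λ e → leftExt e ∷ rightExt e ∷ [])

barPt : Point → Point
barPt tel         = tel
barPt (ext n b h) = ext n (not b) h

facingPt : Point → Point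
facingPt tel         = tel
facingPt (ext n b h) = ext n (not b) (not h)

markerOf : Point → ℕ
markerOf tel         = 0
markerOf (ext n _ _) = n

barPt-involutive : ∀ p → barPt (barPt p) ≡ p
barPt-involutive tel         = refl
barPt-involutive (ext n b h) = cong (λ c → ext n c h) (not-involutive b)

extremities-otherEnd : ∀ {n b h} es → ext n b h ∈ extremities es → ext n b (not h) ∈ extremities es
extremities-otherEnd (mkEntry s n b ∷ es) (here refl) rewrite not-involutive s = there (here refl)
extremities-otherEnd (mkEntry s n b ∷ es) (there (here refl))                  = here refl
extremities-otherEnd (e ∷ es)             (there (there p∈es))                 =
  there (there (extremities-otherEnd es p∈es))

≡-or-≡not : ∀ b c → b ≡ c ⊎ b ≡ not c
≡-or-≡not false false = inj₁ refl
≡-or-≡not false true  = inj₂ refl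
≡-or-≡not true  false = inj₂ refl
≡-or-≡not true  true  = inj₁ refl

markerPoints : ∀ e b h →
  ext (name e) b h ∈ leftExt e ∷ rightExt e ∷ leftExt (barEntry e) ∷ rightExt (barEntry e) ∷ []
markerPoints (mkEntry s n c) b h with ≡-or-≡not b c | ≡-or-≡not h s
... | inj₁ refl | inj₁ refl = there (here refl)
... | inj₁ refl | inj₂ refl = here refl
... | inj₂ refl | inj₁ refl = there (there (there (here refl)))
... | inj₂ refl | inj₂ refl = there (there (here refl))

tel∉extremities : ∀ es → tel ∉ extremities es
tel∉extremities (e ∷ es) (there (there tel∈es)) = tel∉extremities es tel∈es

extremities⇒∈ : ∀ {n b h} es → ext n b h ∈ extremities es →
                ∃[ e ] (e ∈ es × name e ≡ n × barred e ≡ b)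
extremities⇒∈ (e ∷ es) (here refl)         = e , here refl , refl , refl
extremities⇒∈ (e ∷ es) (there (here refl)) = e , here refl , refl , refl
extremities⇒∈ (e ∷ es) (there (there p∈es)) with extremities⇒∈ es p∈es
... | e' , e'∈es , eqs = e' , there e'∈es , eqs

ext-injective : ∀ {n m b c h k} → ext n b h ≡ ext m c k → n ≡ m × b ≡ c × h ≡ k
ext-injective refl = refl , refl , refl

Unique-extremities : ∀ es → Unique (map name es) → Unique (extremities es)
Unique-extremities []       _            = []
Unique-extremities (e ∷ es) (e∉es ∷ uniq) =
  (leftExt≢rightExt e ∷ ¬Any⇒All¬ _ absent) ∷ ¬Any⇒All¬ _ absent ∷ Unique-extremities es uniq
  where
    absent : ∀ {b h} → ext (name e) b h ∉ extremities es
    absent p∈es with extremities⇒∈ es p∈es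
    ... | e' , e'∈es , eq , _ = All.lookup e∉es (∈-map⁺ name e'∈es) (sym eq)

proper : Point → List Point
proper tel         = []
proper (ext n b h) = [ ext n b h ]

adjPoints : List Adj → List Point
adjPoints = concatMap (λ a → proper (proj₁ a) ++ proper (proj₂ a))

adjPoints-++ : ∀ xs ys → adjPoints (xs ++ ys) ≡ adjPoints xs ++ adjPoints ys
adjPoints-++ = List.concatMap-++ _

nonzero : ℕ → List ℕ
nonzero zero    = []
nonzero (suc k) = [ suc k ]

codePoints : List (ℕ × ℕ) → List ℕ
codePoints = concatMap (λ c → nonzero (proj₁ c) ++ nonzero (proj₂ c))

map-code-proper : ∀ p → map code (proper p) ≡ nonzero (code p)
map-code-proper tel         = refl
map-code-proper (ext n b h) = refl

codePoints-cadj : ∀ p q → codePoints [ cadj (p , q) ] ↭ map code (proper p ++ proper q)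
codePoints-cadj p q rewrite List.map-++ code (proper p) (proper q) | map-code-proper p | map-code-proper q =
  go (cadj (p , q)) (cadj-ordered p q)
  where
    go : ∀ c → c ≡ (code p , code q) ⊎ c ≡ (code q , code p) →
         codePoints [ c ] ↭ nonzero (code p) ++ nonzero (code q)
    go _ (inj₁ refl) = ↭-reflexive (List.++-identityʳ _)
    go _ (inj₂ refl) = ↭-trans (↭-reflexive (List.++-identityʳ _)) (++-comm (nonzero (code q)) (nonzero (code p)))

codePoints-canon₁ : ∀ a → codePoints (canon₁ a) ↭ map code (proper (proj₁ a) ++ proper (proj₂ a))
codePoints-canon₁ (tel , tel)       = ↭-refl
codePoints-canon₁ (tel , ext n b h) = codePoints-cadj tel (ext n b h)
codePoints-canon₁ (ext n b h , q)   = codePoints-cadj (ext n b h) q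

codePoints-canon : ∀ xs → codePoints (canon xs) ↭ map code (adjPoints xs)
codePoints-canon xs
  rewrite canon≡concatMap xs | concatMap-concatMap (λ c → nonzero (proj₁ c) ++ nonzero (proj₂ c)) canon₁ xs
        | List.map-concatMap code (λ a → proper (proj₁ a) ++ proper (proj₂ a)) xs
  = concatMap-cong-↭ codePoints-canon₁ xs

map-decode-code : ∀ ps → map decode (map code ps) ≡ ps
map-decode-code ps = trans (sym (List.map-∘ ps)) (trans (List.map-cong decode-code ps) (List.map-id ps))

adjPoints-resp-canon : ∀ {xs ys} → canon xs ↭ canon ys → adjPoints xs ↭ adjPoints ys
adjPoints-resp-canon {xs} {ys} xs≈ys = begin
  adjPoints xs                          ≡⟨ map-decode-code (adjPoints xs) ⟨
  map decode (map code (adjPoints xs))  ↭⟨ map⁺ decode (codePoints-canon xs) ⟨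
  map decode (codePoints (canon xs))    ↭⟨ map⁺ decode (concatMap⁺ _ xs≈ys) ⟩
  map decode (codePoints (canon ys))    ↭⟨ map⁺ decode (codePoints-canon ys) ⟩
  map decode (map code (adjPoints ys))  ≡⟨ map-decode-code (adjPoints ys) ⟩
  adjPoints ys                          ∎
  where open PermutationReasoning

chainAdjs : Point → List Entry → Point → List Adj
chainAdjs r []       l = [ r , l ]
chainAdjs r (x ∷ xs) l = (r , leftExt x) ∷ chainAdjs (rightExt x) xs l

pairs≡chainAdjs : ∀ u xs v → pairs (u ∷ map ⟨_⟩ xs ++ [ v ]) ≡ chainAdjs (rightPt u) xs (leftPt v)
pairs≡chainAdjs u []       v = refl
pairs≡chainAdjs u (x ∷ xs) v = cong (adj u ⟨ x ⟩ ∷_) (pairs≡chainAdjs ⟨ x ⟩ xs v)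

adjPoints-chainAdjs : ∀ r xs l → adjPoints (chainAdjs r xs l) ≡ proper r ++ extremities xs ++ proper l
adjPoints-chainAdjs r []       l = List.++-identityʳ _
adjPoints-chainAdjs r (x ∷ xs) l rewrite adjPoints-chainAdjs (rightExt x) xs l =
  List.++-assoc (proper r) [ leftExt x ] _

adjPoints-adjsC : ∀ c → adjPoints (adjsC c) ↭ extremities (entriesC c)
adjPoints-adjsC (lin xs) rewrite pairs≡chainAdjs ∘ xs ∘ | adjPoints-chainAdjs tel xs tel =
  ↭-reflexive (List.++-identityʳ _)
adjPoints-adjsC (circ []) = ↭-refl
adjPoints-adjsC (circ (x ∷ xs))
  rewrite pairs≡chainAdjs ⟨ x ⟩ xs ⟨ x ⟩ | adjPoints-chainAdjs (rightExt x) xs (leftExt x) =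
  ↭-trans (prep (rightExt x) (++-comm (extremities xs) [ leftExt x ])) (swap (rightExt x) (leftExt x) ↭-refl)

adjPoints-adjs : ∀ G → adjPoints (adjs G) ↭ extremities (entries G)
adjPoints-adjs []      = ↭-refl
adjPoints-adjs (c ∷ G)
  rewrite adjPoints-++ (adjsC c) (adjs G)
        | List.concatMap-++ (λ e → leftExt e ∷ rightExt e ∷ []) (entriesC c) (entries G)
  = ++⁺ (adjPoints-adjsC c) (adjPoints-adjs G)

hasAdjs⇒extremities-↭ : ∀ {G} X → G hasAdjs X → extremities (entries G) ↭ adjPoints X
hasAdjs⇒extremities-↭ {G} X G∼X =
  ↭-trans (↭-sym (adjPoints-adjs G)) (adjPoints-resp-canon {adjs G} {X} G∼X)

leftPt-negElt : ∀ x → leftPt (negElt x) ≡ rightPt x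
leftPt-negElt ∘                  = refl
leftPt-negElt ⟨ mkEntry s n b ⟩ rewrite not-involutive s = refl

rightPt-negElt : ∀ x → rightPt (negElt x) ≡ leftPt x
rightPt-negElt ∘                  = refl
rightPt-negElt ⟨ mkEntry s n b ⟩ = refl

adjPoints-rejoin₁ : ∀ a b c d → adjPoints (adj a d ∷ adj c b ∷ []) ↭ adjPoints (adj a b ∷ adj c d ∷ [])
adjPoints-rejoin₁ a b c d = begin
  (A ++ D) ++ (C ++ B) ++ [] ≡⟨ cong (λ zs → (A ++ D) ++ zs) (List.++-identityʳ (C ++ B)) ⟩
  (A ++ D) ++ C ++ B         ↭⟨ ++-interchange-↭ A D C B ⟩
  (A ++ C) ++ D ++ B         ↭⟨ ++⁺ˡ (A ++ C) (++-comm D B) ⟩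
  (A ++ C) ++ B ++ D         ↭⟨ ++-interchange-↭ A B C D ⟨
  (A ++ B) ++ C ++ D         ≡⟨ cong (λ zs → (A ++ B) ++ zs) (List.++-identityʳ (C ++ D)) ⟨
  (A ++ B) ++ (C ++ D) ++ [] ∎
  where
    open PermutationReasoning
    A = proper (rightPt a); B = proper (leftPt b); C = proper (rightPt c); D = proper (leftPt d)

adjPoints-rejoin₂ : ∀ a b c d →
  adjPoints (adj a (negElt c) ∷ adj (negElt b) d ∷ []) ↭ adjPoints (adj a b ∷ adj c d ∷ [])
adjPoints-rejoin₂ a b c d rewrite leftPt-negElt c | rightPt-negElt b = begin
  (A ++ C) ++ (B ++ D) ++ [] ≡⟨ cong ((A ++ C) ++_) (List.++-assoc B D []) ⟩
  (A ++ C) ++ B ++ D ++ []   ↭⟨ ++-interchange-↭ A C B (D ++ []) ⟩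
  (A ++ B) ++ C ++ D ++ []   ≡⟨ cong ((A ++ B) ++_) (List.++-assoc C D []) ⟨
  (A ++ B) ++ (C ++ D) ++ [] ∎
  where
    open PermutationReasoning
    A = proper (rightPt a); B = proper (leftPt b); C = proper (rightPt c); D = proper (leftPt d)

adjPoints-++⁺ʳ : ∀ xs ys rest → adjPoints xs ↭ adjPoints ys →
                 adjPoints (xs ++ rest) ↭ adjPoints (ys ++ rest)
adjPoints-++⁺ʳ xs ys rest p rewrite adjPoints-++ xs rest | adjPoints-++ ys rest = ++⁺ʳ (adjPoints rest) p

extremities-rejoin : ∀ {G H} X Y rest → G hasAdjs (X ++ rest) → H hasAdjs (Y ++ rest) →
                     adjPoints Y ↭ adjPoints X → extremities (entries G) ↭ extremities (entries H)
extremities-rejoin {G} {H} X Y rest G∼ H∼ Y↭X =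
  ↭-trans (hasAdjs⇒extremities-↭ {G} (X ++ rest) G∼)
    (↭-trans (adjPoints-++⁺ʳ X Y rest (↭-sym Y↭X))
             (↭-sym (hasAdjs⇒extremities-↭ {H} (Y ++ rest) H∼)))

DCJ-extremities : ∀ {G H} → DCJ G H → extremities (entries G) ↭ extremities (entries H)
DCJ-extremities {G} {H} (dcj₁ a b c d rest G∼ H∼ _) =
  extremities-rejoin {G} {H} (adj a b ∷ adj c d ∷ []) (adj a d ∷ adj c b ∷ []) rest G∼ H∼
                     (adjPoints-rejoin₁ a b c d)
DCJ-extremities {G} {H} (dcj₂ a b c d rest G∼ H∼ _) =
  extremities-rejoin {G} {H} (adj a b ∷ adj c d ∷ []) (adj a (negElt c) ∷ adj (negElt b) d ∷ []) rest G∼ H∼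
                     (adjPoints-rejoin₂ a b c d)

Op⇒DCJ : ∀ m {G H} → Op m G H → DCJ G H
Op⇒DCJ dcjModel δ       = δ
Op⇒DCJ revModel (δ , _) = δ

Op-extremities : ∀ m {G H} → Op m G H → extremities (entries G) ↭ extremities (entries H)
Op-extremities m = DCJ-extremities ∘′ Op⇒DCJ m

DCJ-respˡ-≈ : ∀ {G G' H} → G' ≈ G → DCJ G H → DCJ G' H
DCJ-respˡ-≈ G'≈G (dcj₁ a b c d rest G∼ H∼ ne) = dcj₁ a b c d rest (↭-trans G'≈G G∼) H∼ ne
DCJ-respˡ-≈ G'≈G (dcj₂ a b c d rest G∼ H∼ ne) = dcj₂ a b c d rest (↭-trans G'≈G G∼) H∼ ne

Op-respˡ-≈ : ∀ m {G G' H} → G' ≈ G → Op m G H → Op m G' H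
Op-respˡ-≈ dcjModel G'≈G δ = DCJ-respˡ-≈ G'≈G δ
Op-respˡ-≈ revModel G'≈G (δ , c , c' , rest , r , G≈ , H≈) =
  DCJ-respˡ-≈ G'≈G δ , c , c' , rest , r , ↭-trans G'≈G G≈ , H≈

dropBarred-++ : ∀ xs ys → dropBarred (xs ++ ys) ≡ dropBarred xs ++ dropBarred ys
dropBarred-++ []       ys = refl
dropBarred-++ (x ∷ xs) ys with barred x
... | true  = dropBarred-++ xs ys
... | false = cong (x ∷_) (dropBarred-++ xs ys)

module Glue (P : List Point) where

  -- After gluing, an adjacency that used an extremity p ∈ P of x uses `barPt p`, the
  -- same extremity of the copy x̄.
  shiftRule : Relabelling
  shiftRule n b h = if ext n b h ∈ᵇ P then not b else b

  shift : Point → Point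
  shift = relabel shiftRule

  shiftAdj : Adj → Adj
  shiftAdj = relabelAdj shiftRule

  shift-∈ : ∀ {p} → p ∈ P → shift p ≡ barPt p
  shift-∈ {tel}       _   = refl
  shift-∈ {ext n b h} p∈P rewrite Dec.dec-true (ext n b h ∈? P) p∈P = refl

  shift-∉ : ∀ {p} → p ∉ P → shift p ≡ p
  shift-∉ {tel}       _   = refl
  shift-∉ {ext n b h} p∉P rewrite Dec.dec-false (ext n b h ∈? P) p∉P = refl

  shift-proper-∉ : ∀ p → (p ∈ proper p → p ∉ P) → shift p ≡ p
  shift-proper-∉ tel         _   = refl
  shift-proper-∉ (ext n b h) out = shift-∉ (out (here refl))

  map-shiftAdj-outside : ∀ Y → (∀ {p} → p ∈ adjPoints Y → p ∉ P) → map shiftAdj Y ≡ Y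
  map-shiftAdj-outside []            out = refl
  map-shiftAdj-outside ((p , q) ∷ Y) out = cong₂ _∷_
    (cong₂ _,_ (shift-proper-∉ p (out ∘′ ∈-++⁺ˡ ∘′ ∈-++⁺ˡ))
               (shift-proper-∉ q (out ∘′ ∈-++⁺ˡ ∘′ ∈-++⁺ʳ (proper p))))
    (map-shiftAdj-outside Y (out ∘′ ∈-++⁺ʳ (proper p ++ proper q)))

  glueEntry : Entry → List Entry
  glueEntry e = [ barEntry e if leftExt e ∈ᵇ P ] ++ e ∷ [ barEntry e if rightExt e ∈ᵇ P ]

  innerAdjs : Entry → List Adj
  innerAdjs e = [ adj ⟨ barEntry e ⟩ ⟨ e ⟩ if leftExt e ∈ᵇ P ]
             ++ [ adj ⟨ e ⟩ ⟨ barEntry e ⟩ if rightExt e ∈ᵇ P ]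

  glueChromosome : Chromosome → Chromosome
  glueChromosome (lin xs)  = lin (concatMap glueEntry xs)
  glueChromosome (circ xs) = circ (concatMap glueEntry xs)

  glue : Genome → Genome
  glue = map glueChromosome

  entries-glue : ∀ G → entries (glue G) ≡ concatMap glueEntry (entries G)
  entries-glue []      = refl
  entries-glue (c ∷ G) = trans (cong₂ _++_ (entriesC-glue c) (entries-glue G))
                               (sym (List.concatMap-++ glueEntry (entriesC c) (entries G)))
    where
      entriesC-glue : ∀ c → entriesC (glueChromosome c) ≡ concatMap glueEntry (entriesC c)
      entriesC-glue (lin xs)  = refl
      entriesC-glue (circ xs) = refl

  chainAdjs-glueˡ : ∀ r x W l → chainAdjs r ([ barEntry x if leftExt x ∈ᵇ P ] ++ x ∷ W) l
                    ≡ (r , shift (leftExt x)) ∷ [ adj ⟨ barEntry x ⟩ ⟨ x ⟩ if leftExt x ∈ᵇ P ]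
                      ++ chainAdjs (rightExt x) W l
  chainAdjs-glueˡ r x W l with leftExt x ∈? P
  ... | yes _ = refl
  ... | no _  = refl

  chainAdjs-glueʳ : ∀ x W l → chainAdjs (rightExt x) ([ barEntry x if rightExt x ∈ᵇ P ] ++ W) l
                    ≡ [ adj ⟨ x ⟩ ⟨ barEntry x ⟩ if rightExt x ∈ᵇ P ] ++ chainAdjs (shift (rightExt x)) W l
  chainAdjs-glueʳ x W l with rightExt x ∈? P
  ... | yes _ = refl
  ... | no _  = refl

  chainAdjs-glue : ∀ xs r l → chainAdjs (shift r) (concatMap glueEntry xs) (shift l)
                              ↭ map shiftAdj (chainAdjs r xs l) ++ concatMap innerAdjs xs
  chainAdjs-glue []       r l = ↭-refl
  chainAdjs-glue (x ∷ xs) r l = begin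
    chainAdjs (shift r) ((Lx ++ x ∷ Rx) ++ Z) (shift l)
      ≡⟨ cong (λ ys → chainAdjs (shift r) ys (shift l)) (List.++-assoc Lx (x ∷ Rx) Z) ⟩
    chainAdjs (shift r) (Lx ++ x ∷ Rx ++ Z) (shift l)
      ≡⟨ chainAdjs-glueˡ (shift r) x (Rx ++ Z) (shift l) ⟩
    a₀ ∷ La ++ chainAdjs (rightExt x) (Rx ++ Z) (shift l)
      ≡⟨ cong (λ ys → a₀ ∷ La ++ ys) (chainAdjs-glueʳ x Z (shift l)) ⟩
    a₀ ∷ La ++ Ra ++ chainAdjs (shift (rightExt x)) Z (shift l)
      ↭⟨ prep a₀ (++⁺ˡ La (++⁺ˡ Ra (chainAdjs-glue xs (rightExt x) l))) ⟩
    a₀ ∷ La ++ Ra ++ M ++ Gs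
      ≡⟨ cong (a₀ ∷_) (List.++-assoc La Ra (M ++ Gs)) ⟨
    a₀ ∷ (La ++ Ra) ++ M ++ Gs
      ↭⟨ prep a₀ (shifts (La ++ Ra) M) ⟩
    a₀ ∷ M ++ (La ++ Ra) ++ Gs ∎
    where
      open PermutationReasoning
      Lx = [ barEntry x if leftExt x ∈ᵇ P ]
      Rx = [ barEntry x if rightExt x ∈ᵇ P ]
      La = [ adj ⟨ barEntry x ⟩ ⟨ x ⟩ if leftExt x ∈ᵇ P ]
      Ra = [ adj ⟨ x ⟩ ⟨ barEntry x ⟩ if rightExt x ∈ᵇ P ]
      Z  = concatMap glueEntry xs
      a₀ = shift r , shift (leftExt x)
      M  = map shiftAdj (chainAdjs (rightExt x) xs l)
      Gs = concatMap innerAdjs xs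

  adjsC-glue : ∀ c → adjsC (glueChromosome c) ↭ map shiftAdj (adjsC c) ++ concatMap innerAdjs (entriesC c)
  adjsC-glue (lin xs) rewrite pairs≡chainAdjs ∘ (concatMap glueEntry xs) ∘ | pairs≡chainAdjs ∘ xs ∘ =
    chainAdjs-glue xs tel tel
  adjsC-glue (circ [])       = ↭-refl
  adjsC-glue (circ (x ∷ xs))
    rewrite List.++-assoc [ barEntry x if leftExt x ∈ᵇ P ] (x ∷ [ barEntry x if rightExt x ∈ᵇ P ])
                          (concatMap glueEntry xs)
          | pairs≡chainAdjs ⟨ x ⟩ xs ⟨ x ⟩
    with leftExt x ∈? P
  ... | no x∉ = begin
    adjsC (circ (x ∷ Rx ++ Z))
      ≡⟨ pairs≡chainAdjs ⟨ x ⟩ (Rx ++ Z) ⟨ x ⟩ ⟩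
    chainAdjs (rightExt x) (Rx ++ Z) (leftExt x)
      ≡⟨ chainAdjs-glueʳ x Z (leftExt x) ⟩
    Ra ++ chainAdjs (shift (rightExt x)) Z (leftExt x)
      ≡⟨ cong (λ p → Ra ++ chainAdjs (shift (rightExt x)) Z p) (shift-∉ x∉) ⟨
    Ra ++ chainAdjs (shift (rightExt x)) Z (shift (leftExt x))
      ↭⟨ ++⁺ˡ Ra (chainAdjs-glue xs (rightExt x) (leftExt x)) ⟩
    Ra ++ M ++ Gs
      ↭⟨ shifts Ra M ⟩
    M ++ Ra ++ Gs ∎
    where
      open PermutationReasoning
      Rx = [ barEntry x if rightExt x ∈ᵇ P ]
      Ra = [ adj ⟨ x ⟩ ⟨ barEntry x ⟩ if rightExt x ∈ᵇ P ]
      Z  = concatMap glueEntry xs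
      M  = map shiftAdj (chainAdjs (rightExt x) xs (leftExt x))
      Gs = concatMap innerAdjs xs
  ... | yes x∈ = begin
    adjsC (circ (barEntry x ∷ x ∷ Rx ++ Z))
      ≡⟨ pairs≡chainAdjs ⟨ barEntry x ⟩ (x ∷ Rx ++ Z) ⟨ barEntry x ⟩ ⟩
    a₀ ∷ chainAdjs (rightExt x) (Rx ++ Z) (leftExt (barEntry x))
      ≡⟨ cong (a₀ ∷_) (chainAdjs-glueʳ x Z (leftExt (barEntry x))) ⟩
    a₀ ∷ Ra ++ chainAdjs (shift (rightExt x)) Z (leftExt (barEntry x))
      ≡⟨ cong (λ p → a₀ ∷ Ra ++ chainAdjs (shift (rightExt x)) Z p) (shift-∈ x∈) ⟨
    a₀ ∷ Ra ++ chainAdjs (shift (rightExt x)) Z (shift (leftExt x))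
      ↭⟨ prep a₀ (++⁺ˡ Ra (chainAdjs-glue xs (rightExt x) (leftExt x))) ⟩
    a₀ ∷ Ra ++ M ++ Gs
      ↭⟨ prep a₀ (shifts Ra M) ⟩
    a₀ ∷ M ++ Ra ++ Gs
      ↭⟨ shifts M [ a₀ ] ⟨
    M ++ a₀ ∷ Ra ++ Gs ∎
    where
      open PermutationReasoning
      a₀ = adj ⟨ barEntry x ⟩ ⟨ x ⟩
      Rx = [ barEntry x if rightExt x ∈ᵇ P ]
      Ra = [ adj ⟨ x ⟩ ⟨ barEntry x ⟩ if rightExt x ∈ᵇ P ]
      Z  = concatMap glueEntry xs
      M  = map shiftAdj (chainAdjs (rightExt x) xs (leftExt x))
      Gs = concatMap innerAdjs xs

  adjs-glue : ∀ G → adjs (glue G) ↭ map shiftAdj (adjs G) ++ concatMap innerAdjs (entries G)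
  adjs-glue []      = ↭-refl
  adjs-glue (c ∷ G) = begin
    adjsC (glueChromosome c) ++ adjs (glue G)
      ↭⟨ ++⁺ (adjsC-glue c) (adjs-glue G) ⟩
    (map shiftAdj (adjsC c) ++ Ic) ++ (map shiftAdj (adjs G) ++ IG)
      ↭⟨ ++-interchange-↭ (map shiftAdj (adjsC c)) Ic (map shiftAdj (adjs G)) IG ⟩
    (map shiftAdj (adjsC c) ++ map shiftAdj (adjs G)) ++ (Ic ++ IG)
      ≡⟨ cong₂ _++_ (List.map-++ shiftAdj (adjsC c) (adjs G))
                    (List.concatMap-++ innerAdjs (entriesC c) (entries G)) ⟨
    map shiftAdj (adjs (c ∷ G)) ++ concatMap innerAdjs (entries (c ∷ G)) ∎
    where
      open PermutationReasoning
      Ic = concatMap innerAdjs (entriesC c)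
      IG = concatMap innerAdjs (entries G)

  newAdjAt : Point → List Adj
  newAdjAt p = [ (p , facingPt p) if p ∈ᵇ P ]

  newAdjsAt : List Point → List Adj
  newAdjsAt = concatMap newAdjAt

  newAdjsAt-outside : ∀ ps → (∀ {p} → p ∈ ps → p ∉ P) → newAdjsAt ps ≡ []
  newAdjsAt-outside []       out = refl
  newAdjsAt-outside (p ∷ ps) out rewrite Dec.dec-false (p ∈? P) (out (here refl)) =
    newAdjsAt-outside ps (out ∘′ there)

  canon-innerAdjs : ∀ e → canon (innerAdjs e) ≡ canon (newAdjsAt (leftExt e ∷ rightExt e ∷ []))
  canon-innerAdjs (mkEntry s n b) with ext n b (not s) ∈? P | ext n b s ∈? P
  ... | no _  | no _  = refl
  ... | no _  | yes _ = refl
  ... | yes _ | no _  rewrite not-involutive s = cong [_] (cadj-comm (ext n (not b) s) (ext n b (not s)))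
  ... | yes _ | yes _ rewrite not-involutive s =
    cong (_∷ [ cadj (ext n b s , ext n (not b) (not s)) ]) (cadj-comm (ext n (not b) s) (ext n b (not s)))

  canon-concatMap-innerAdjs : ∀ es → canon (concatMap innerAdjs es) ≡ canon (newAdjsAt (extremities es))
  canon-concatMap-innerAdjs []       = refl
  canon-concatMap-innerAdjs (e ∷ es) = begin
    canon (innerAdjs e ++ concatMap innerAdjs es)
      ≡⟨ canon-++ (innerAdjs e) (concatMap innerAdjs es) ⟩
    canon (innerAdjs e) ++ canon (concatMap innerAdjs es)
      ≡⟨ cong₂ _++_ (canon-innerAdjs e) (canon-concatMap-innerAdjs es) ⟩
    canon (newAdjsAt (leftExt e ∷ rightExt e ∷ [])) ++ canon (newAdjsAt (extremities es))
      ≡⟨ canon-++ (newAdjsAt (leftExt e ∷ rightExt e ∷ [])) (newAdjsAt (extremities es)) ⟨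
    canon (newAdjsAt (leftExt e ∷ rightExt e ∷ []) ++ newAdjsAt (extremities es))
      ≡⟨ cong canon (List.concatMap-++ newAdjAt (leftExt e ∷ rightExt e ∷ []) (extremities es)) ⟨
    canon (newAdjsAt (extremities (e ∷ es))) ∎
    where open ≡-Reasoning

  canon-adjs-glue : ∀ G → canon (adjs (glue G))
                          ↭ canon (map shiftAdj (adjs G)) ++ canon (newAdjsAt (extremities (entries G)))
  canon-adjs-glue G = begin
    canon (adjs (glue G))
      ↭⟨ canon-↭ (adjs-glue G) ⟩
    canon (map shiftAdj (adjs G) ++ concatMap innerAdjs (entries G))
      ≡⟨ canon-++ (map shiftAdj (adjs G)) (concatMap innerAdjs (entries G)) ⟩
    canon (map shiftAdj (adjs G)) ++ canon (concatMap innerAdjs (entries G))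
      ≡⟨ cong (canon (map shiftAdj (adjs G)) ++_) (canon-concatMap-innerAdjs (entries G)) ⟩
    canon (map shiftAdj (adjs G)) ++ canon (newAdjsAt (extremities (entries G))) ∎
    where open PermutationReasoning

  hasAdjs-glue : ∀ {G} X → G hasAdjs X → glue G hasAdjs (map shiftAdj X ++ newAdjsAt (adjPoints X))
  hasAdjs-glue {G} X G∼X = begin
    canon (adjs (glue G))
      ↭⟨ canon-adjs-glue G ⟩
    canon (map shiftAdj (adjs G)) ++ canon (newAdjsAt (extremities (entries G)))
      ↭⟨ ++⁺ (canon-relabelAdj-↭ shiftRule {adjs G} {X} G∼X)
             (canon-↭ (concatMap⁺ newAdjAt (hasAdjs⇒extremities-↭ {G} X G∼X))) ⟩
    canon (map shiftAdj X) ++ canon (newAdjsAt (adjPoints X))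
      ≡⟨ canon-++ (map shiftAdj X) (newAdjsAt (adjPoints X)) ⟨
    canon (map shiftAdj X ++ newAdjsAt (adjPoints X)) ∎
    where open PermutationReasoning

  glue-resp-≈ : ∀ {G H} → G ≈ H → glue G ≈ glue H
  glue-resp-≈ {G} {H} G≈H =
    ↭-trans (hasAdjs-glue {G} (adjs H) G≈H) (↭-sym (hasAdjs-glue {H} (adjs H) ↭-refl))

  shiftʳ shiftˡ : Elt → Elt
  shiftʳ ∘     = ∘
  shiftʳ ⟨ e ⟩ = if rightExt e ∈ᵇ P then ⟨ barEntry e ⟩ else ⟨ e ⟩
  shiftˡ ∘     = ∘
  shiftˡ ⟨ e ⟩ = if leftExt e ∈ᵇ P then ⟨ barEntry e ⟩ else ⟨ e ⟩

  rightPt-shiftʳ : ∀ x → rightPt (shiftʳ x) ≡ shift (rightPt x)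
  rightPt-shiftʳ ∘     = refl
  rightPt-shiftʳ ⟨ e ⟩ with rightExt e ∈? P
  ... | yes _ = refl
  ... | no _  = refl

  leftPt-shiftˡ : ∀ x → leftPt (shiftˡ x) ≡ shift (leftPt x)
  leftPt-shiftˡ ∘     = refl
  leftPt-shiftˡ ⟨ e ⟩ with leftExt e ∈? P
  ... | yes _ = refl
  ... | no _  = refl

  map-shiftAdj-adj : ∀ a b c d →
    map shiftAdj (adj a b ∷ adj c d ∷ []) ≡ adj (shiftʳ a) (shiftˡ b) ∷ adj (shiftʳ c) (shiftˡ d) ∷ []
  map-shiftAdj-adj a b c d = sym (cong₂ _∷_
    (cong₂ _,_ (rightPt-shiftʳ a) (leftPt-shiftˡ b))
    (cong₂ _∷_ (cong₂ _,_ (rightPt-shiftʳ c) (leftPt-shiftˡ d)) refl))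

  map-shiftAdj-adj-negElt : ∀ a b c d →
    map shiftAdj (adj a (negElt c) ∷ adj (negElt b) d ∷ [])
    ≡ adj (shiftʳ a) (negElt (shiftʳ c)) ∷ adj (negElt (shiftˡ b)) (shiftˡ d) ∷ []
  map-shiftAdj-adj-negElt a b c d = sym (cong₂ _∷_
    (cong₂ _,_ (rightPt-shiftʳ a) (shiftʳ-negElt c))
    (cong₂ _∷_ (cong₂ _,_ (shiftˡ-negElt b) (leftPt-shiftˡ d)) refl))
    where
      shiftʳ-negElt : ∀ c → leftPt (negElt (shiftʳ c)) ≡ shift (leftPt (negElt c))
      shiftʳ-negElt c = begin
        leftPt (negElt (shiftʳ c)) ≡⟨ leftPt-negElt (shiftʳ c) ⟩
        rightPt (shiftʳ c)         ≡⟨ rightPt-shiftʳ c ⟩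
        shift (rightPt c)          ≡⟨ cong shift (leftPt-negElt c) ⟨
        shift (leftPt (negElt c))  ∎
        where open ≡-Reasoning
      shiftˡ-negElt : ∀ b → rightPt (negElt (shiftˡ b)) ≡ shift (rightPt (negElt b))
      shiftˡ-negElt b = begin
        rightPt (negElt (shiftˡ b)) ≡⟨ rightPt-negElt (shiftˡ b) ⟩
        leftPt (shiftˡ b)           ≡⟨ leftPt-shiftˡ b ⟩
        shift (leftPt b)            ≡⟨ cong shift (rightPt-negElt b) ⟨
        shift (rightPt (negElt b))  ∎
        where open ≡-Reasoning

  unshiftRule : Relabelling
  unshiftRule n b h = if ext n (not b) h ∈ᵇ P then not b else b

  unshift : Point → Point
  unshift = relabel unshiftRule

  ShiftInvertibleOn : List Point → Set
  ShiftInvertibleOn ps = ∀ {p} → p ∈ ps → unshift (shift p) ≡ p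

  map-unshift-shift : ∀ Y → ShiftInvertibleOn (adjPoints Y) →
                      map (relabelAdj unshiftRule) (map shiftAdj Y) ≡ Y
  map-unshift-shift []            inv = refl
  map-unshift-shift ((p , q) ∷ Y) inv = cong₂ _∷_
    (cong₂ _,_ (onProper p (inv ∘′ ∈-++⁺ˡ ∘′ ∈-++⁺ˡ))
               (onProper q (inv ∘′ ∈-++⁺ˡ ∘′ ∈-++⁺ʳ (proper p))))
    (map-unshift-shift Y (inv ∘′ ∈-++⁺ʳ (proper p ++ proper q)))
    where
      onProper : ∀ p → (p ∈ proper p → unshift (shift p) ≡ p) → unshift (shift p) ≡ p
      onProper tel         _   = refl
      onProper (ext n b h) inv = inv (here refl)

  canon-shiftAdj-injective : ∀ Y Y' → ShiftInvertibleOn (adjPoints Y) → ShiftInvertibleOn (adjPoints Y') →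
                             canon (map shiftAdj Y) ↭ canon (map shiftAdj Y') → canon Y ↭ canon Y'
  canon-shiftAdj-injective Y Y' inv inv' eq
    with canon-relabelAdj-↭ unshiftRule {map shiftAdj Y} {map shiftAdj Y'} eq
  ... | eq′ rewrite map-unshift-shift Y inv | map-unshift-shift Y' inv' = eq′

  glue-rejoin : ∀ {G H} X Y {X′ Y′} rest → map shiftAdj X ≡ X′ → map shiftAdj Y ≡ Y′ →
                ShiftInvertibleOn (extremities (entries G)) →
                G hasAdjs (X ++ rest) → H hasAdjs (Y ++ rest) →
                adjPoints Y ↭ adjPoints X → ¬ (canon X ↭ canon Y) →
                ∃[ rest′ ] (glue G hasAdjs (X′ ++ rest′) × glue H hasAdjs (Y′ ++ rest′)
                            × ¬ (canon X′ ↭ canon Y′))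
  glue-rejoin {G} {H} X Y rest refl refl inv G∼ H∼ Y↭X X≉Y =
    map shiftAdj rest ++ newAdjsAt (adjPoints (X ++ rest)) ,
    ↭-trans (hasAdjs-glue {G} (X ++ rest) G∼) (↭-reflexive (cong canon (reassoc X))) ,
    ↭-trans (hasAdjs-glue {H} (Y ++ rest) H∼)
      (↭-trans (↭-reflexive (cong canon (reassoc Y)))
               (canon-↭ (++⁺ˡ (map shiftAdj Y) (++⁺ˡ (map shiftAdj rest)
                           (concatMap⁺ newAdjAt (adjPoints-++⁺ʳ Y X rest Y↭X)))))) ,
    λ eq → X≉Y (canon-shiftAdj-injective X Y invX (invX ∘′ ∈-resp-↭ Y↭X) eq)
    where
      reassoc : ∀ Z → map shiftAdj (Z ++ rest) ++ newAdjsAt (adjPoints (Z ++ rest))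
                      ≡ map shiftAdj Z ++ map shiftAdj rest ++ newAdjsAt (adjPoints (Z ++ rest))
      reassoc Z = trans (cong (_++ newAdjsAt (adjPoints (Z ++ rest))) (List.map-++ shiftAdj Z rest))
                        (List.++-assoc (map shiftAdj Z) (map shiftAdj rest) (newAdjsAt (adjPoints (Z ++ rest))))
      invX : ShiftInvertibleOn (adjPoints X)
      invX {p} p∈X = inv (∈-resp-↭ (↭-sym (hasAdjs⇒extremities-↭ {G} (X ++ rest) G∼))
                                   (subst (p ∈_) (sym (adjPoints-++ X rest)) (∈-++⁺ˡ p∈X)))

  glue-DCJ : ∀ {G H} → ShiftInvertibleOn (extremities (entries G)) → DCJ G H → DCJ (glue G) (glue H)
  glue-DCJ {G} {H} inv (dcj₁ a b c d rest G∼ H∼ X≉Y)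
    with glue-rejoin {G} {H} (adj a b ∷ adj c d ∷ []) (adj a d ∷ adj c b ∷ []) rest
           (map-shiftAdj-adj a b c d) (map-shiftAdj-adj a d c b) inv G∼ H∼ (adjPoints-rejoin₁ a b c d) X≉Y
  ... | rest′ , gG∼ , gH∼ , X≉Y′ =
    dcj₁ (shiftʳ a) (shiftˡ b) (shiftʳ c) (shiftˡ d) rest′ gG∼ gH∼ X≉Y′
  glue-DCJ {G} {H} inv (dcj₂ a b c d rest G∼ H∼ X≉Y)
    with glue-rejoin {G} {H} (adj a b ∷ adj c d ∷ []) (adj a (negElt c) ∷ adj (negElt b) d ∷ []) rest
           (map-shiftAdj-adj a b c d) (map-shiftAdj-adj-negElt a b c d) inv G∼ H∼
           (adjPoints-rejoin₂ a b c d) X≉Y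
  ... | rest′ , gG∼ , gH∼ , X≉Y′ =
    dcj₂ (shiftʳ a) (shiftˡ b) (shiftʳ c) (shiftˡ d) rest′ gG∼ gH∼ X≉Y′

  glueEntry-negEntry : ∀ e → glueEntry (negEntry e) ≡ revNeg (glueEntry e)
  glueEntry-negEntry (mkEntry s n b) rewrite not-involutive s with ext n b (not s) ∈? P | ext n b s ∈? P
  ... | no _  | no _  = refl
  ... | no _  | yes _ = refl
  ... | yes _ | no _  = refl
  ... | yes _ | yes _ = refl

  concatMap-glueEntry-revNeg : ∀ xs → concatMap glueEntry (revNeg xs) ≡ revNeg (concatMap glueEntry xs)
  concatMap-glueEntry-revNeg []       = refl
  concatMap-glueEntry-revNeg (x ∷ xs) = begin
    concatMap glueEntry (reverse (negEntry x ∷ map negEntry xs))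
      ≡⟨ cong (concatMap glueEntry) (List.unfold-reverse (negEntry x) (map negEntry xs)) ⟩
    concatMap glueEntry (revNeg xs ++ [ negEntry x ])
      ≡⟨ List.concatMap-++ glueEntry (revNeg xs) [ negEntry x ] ⟩
    concatMap glueEntry (revNeg xs) ++ glueEntry (negEntry x) ++ []
      ≡⟨ cong₂ _++_ (concatMap-glueEntry-revNeg xs) (trans (List.++-identityʳ _) (glueEntry-negEntry x)) ⟩
    revNeg (concatMap glueEntry xs) ++ revNeg (glueEntry x)
      ≡⟨ List.reverse-++ (map negEntry (glueEntry x)) (map negEntry (concatMap glueEntry xs)) ⟨
    reverse (map negEntry (glueEntry x) ++ map negEntry (concatMap glueEntry xs))
      ≡⟨ cong reverse (List.map-++ negEntry (glueEntry x) (concatMap glueEntry xs)) ⟨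
    revNeg (concatMap glueEntry (x ∷ xs)) ∎
    where open ≡-Reasoning

  glue-SegRev : ∀ {c c'} → SegRev c c' → SegRev (glueChromosome c) (glueChromosome c')
  glue-SegRev (linRev u s v)
    rewrite concatMap-++-++ glueEntry u s v | concatMap-++-++ glueEntry u (revNeg s) v | concatMap-glueEntry-revNeg s
    = linRev (concatMap glueEntry u) (concatMap glueEntry s) (concatMap glueEntry v)
  glue-SegRev (circRev u s v)
    rewrite concatMap-++-++ glueEntry u s v | concatMap-++-++ glueEntry u (revNeg s) v | concatMap-glueEntry-revNeg s
    = circRev (concatMap glueEntry u) (concatMap glueEntry s) (concatMap glueEntry v)

  glue-Reversal : ∀ {G H} → ShiftInvertibleOn (extremities (entries G)) →
                  Reversal G H → Reversal (glue G) (glue H)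
  glue-Reversal {G} {H} inv (δ , c , c' , rest , r , G≈ , H≈) =
    glue-DCJ inv δ , glueChromosome c , glueChromosome c' , glue rest , glue-SegRev r ,
    glue-resp-≈ {G} {c ∷ rest} G≈ , glue-resp-≈ {H} {c' ∷ rest} H≈

  glue-Op : ∀ m {G H} → ShiftInvertibleOn (extremities (entries G)) → Op m G H → Op m (glue G) (glue H)
  glue-Op dcjModel = glue-DCJ
  glue-Op revModel = glue-Reversal

  glueEntry-∈ : ∀ e {e'} → e' ∈ glueEntry e →
    e' ≡ e ⊎ (e' ≡ barEntry e
              × (adj ⟨ barEntry e ⟩ ⟨ e ⟩ ∈ innerAdjs e ⊎ adj ⟨ e ⟩ ⟨ barEntry e ⟩ ∈ innerAdjs e))
  glueEntry-∈ e e'∈ with leftExt e ∈? P | rightExt e ∈? P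
  glueEntry-∈ e (here refl)                 | no _  | _     = inj₁ refl
  glueEntry-∈ e (there (here refl))         | no _  | yes _ = inj₂ (refl , inj₂ (here refl))
  glueEntry-∈ e (here refl)                 | yes _ | _     = inj₂ (refl , inj₁ (here refl))
  glueEntry-∈ e (there (here refl))         | yes _ | _     = inj₁ refl
  glueEntry-∈ e (there (there (here refl))) | yes _ | yes _ = inj₂ (refl , inj₂ (there (here refl)))

  name-glueEntry : ∀ e {e'} → e' ∈ glueEntry e → name e' ≡ name e
  name-glueEntry e e'∈ with glueEntry-∈ e e'∈
  ... | inj₁ refl       = refl
  ... | inj₂ (refl , _) = refl

  ∈-glueEntry : ∀ e → e ∈ glueEntry e
  ∈-glueEntry e with leftExt e ∈? P
  ... | yes _ = there (here refl)
  ... | no _  = here refl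

  keys-glueEntry-unique : ∀ e → barred e ≡ false → ¬ (leftExt e ∈ P × rightExt e ∈ P) →
                          Unique (map key (glueEntry e))
  keys-glueEntry-unique (mkEntry s n _) refl notBoth with ext n false (not s) ∈? P | ext n false s ∈? P
  ... | no _  | no _  = [] ∷ []
  ... | yes _ | no _  = ((λ ()) ∷ []) ∷ [] ∷ []
  ... | no _  | yes _ = ((λ ()) ∷ []) ∷ [] ∷ []
  ... | yes l | yes r = ⊥-elim (notBoth (l , r))

  keys-glue-unique : ∀ es → All (λ e → barred e ≡ false) es → Unique (map name es) →
                     (∀ {e} → e ∈ es → ¬ (leftExt e ∈ P × rightExt e ∈ P)) →
                     Unique (map key (concatMap glueEntry es))
  keys-glue-unique []       _          _           _       = []
  keys-glue-unique (e ∷ es) (e₀ ∷ es₀) (e∉ ∷ uniq) notBoth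
    rewrite List.map-++ key (glueEntry e) (concatMap glueEntry es) =
    Unique-++⁺ (keys-glueEntry-unique e e₀ (notBoth (here refl)))
               (keys-glue-unique es es₀ uniq (notBoth ∘′ there)) disjoint
    where
      disjoint : Disjoint (map key (glueEntry e)) (map key (concatMap glueEntry es))
      disjoint (k∈e , k∈es) with ∈-map⁻ key k∈e | ∈-map⁻ key k∈es
      ... | e₁ , e₁∈ , refl | e₂ , e₂∈ , k≡ with find (∈-concatMap⁻ glueEntry e₂∈)
      ... | e₃ , e₃∈es , e₂∈e₃ = All.lookup e∉ (∈-map⁺ name e₃∈es)
            (trans (sym (name-glueEntry e e₁∈)) (trans (cong proj₁ k≡) (name-glueEntry e₃ e₂∈e₃)))

  dropBarred-glueEntry : ∀ e → barred e ≡ false → dropBarred (glueEntry e) ≡ [ e ]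
  dropBarred-glueEntry (mkEntry s n _) refl with ext n false (not s) ∈? P | ext n false s ∈? P
  ... | no _  | no _  = refl
  ... | yes _ | no _  = refl
  ... | no _  | yes _ = refl
  ... | yes _ | yes _ = refl

  dropBarred-concatMap-glueEntry : ∀ xs → All (λ e → barred e ≡ false) xs →
                                   dropBarred (concatMap glueEntry xs) ≡ xs
  dropBarred-concatMap-glueEntry []       _          = refl
  dropBarred-concatMap-glueEntry (x ∷ xs) (x₀ ∷ xs₀) =
    trans (dropBarred-++ (glueEntry x) (concatMap glueEntry xs))
          (cong₂ _++_ (dropBarred-glueEntry x x₀) (dropBarred-concatMap-glueEntry xs xs₀))

  reduction-glue : ∀ G → All (λ e → barred e ≡ false) (entries G) → reduction (glue G) ≡ G
  reduction-glue []            _ = refl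
  reduction-glue (lin xs ∷ G)  unbarred = cong₂ _∷_
    (cong lin (dropBarred-concatMap-glueEntry xs (++⁻ˡ xs unbarred))) (reduction-glue G (++⁻ʳ xs unbarred))
  reduction-glue (circ xs ∷ G) unbarred = cong₂ _∷_
    (cong circ (dropBarred-concatMap-glueEntry xs (++⁻ˡ xs unbarred))) (reduction-glue G (++⁻ʳ xs unbarred))

open Glue using (glue)

MarkersUnique : List Point → Set
MarkersUnique Q = ∀ {p q} → p ∈ Q → q ∈ Q → markerOf p ≡ markerOf q → p ≡ q

MarkersDisjoint : List Point → List Point → Set
MarkersDisjoint Q R = ∀ {p q} → p ∈ Q → q ∈ R → markerOf p ≢ markerOf q

module _ (Q R : List Point) (uniqueQ : MarkersUnique Q) (disjoint : MarkersDisjoint Q R) where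

  private
    module GQ = Glue Q
    module GR = Glue R
    module GQR = Glue (Q ++ R)

    notInR : ∀ {p} → p ∈ Q → ∀ q → markerOf q ≡ markerOf p → q ∈ᵇ R ≡ false
    notInR p∈Q q eq = Dec.dec-false (q ∈? R) (λ q∈R → disjoint p∈Q q∈R (sym eq))

  glueEntry-++ : ∀ e → GQR.glueEntry e ≡ concatMap GR.glueEntry (GQ.glueEntry e)
  glueEntry-++ e rewrite ∈ᵇ-++ (leftExt e) Q R | ∈ᵇ-++ (rightExt e) Q R
    with leftExt e ∈? Q | rightExt e ∈? Q
  ... | no _ | no _ = sym (List.++-identityʳ _)
  ... | yes l∈Q | yes r∈Q = ⊥-elim (leftExt≢rightExt e (uniqueQ l∈Q r∈Q refl))
  ... | yes p∈Q | no _
    rewrite notInR p∈Q (leftExt e) refl | notInR p∈Q (rightExt e) refl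
          | notInR p∈Q (leftExt (barEntry e)) refl | notInR p∈Q (rightExt (barEntry e)) refl = refl
  ... | no _ | yes p∈Q
    rewrite notInR p∈Q (leftExt e) refl | notInR p∈Q (rightExt e) refl
          | notInR p∈Q (leftExt (barEntry e)) refl | notInR p∈Q (rightExt (barEntry e)) refl = refl

  concatMap-glueEntry-++ : ∀ xs →
    concatMap GQR.glueEntry xs ≡ concatMap GR.glueEntry (concatMap GQ.glueEntry xs)
  concatMap-glueEntry-++ xs =
    trans (List.concatMap-cong glueEntry-++ xs) (sym (concatMap-concatMap GR.glueEntry GQ.glueEntry xs))

  glue-++ : ∀ G → glue (Q ++ R) G ≡ glue R (glue Q G)
  glue-++ []            = refl
  glue-++ (lin xs ∷ G)  = cong₂ _∷_ (cong lin (concatMap-glueEntry-++ xs)) (glue-++ G)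
  glue-++ (circ xs ∷ G) = cong₂ _∷_ (cong circ (concatMap-glueEntry-++ xs)) (glue-++ G)

glue-[] : ∀ G → glue [] G ≡ G
glue-[] []            = refl
glue-[] (lin xs ∷ G)  = cong₂ _∷_ (cong lin (List.concatMap-pure xs)) (glue-[] G)
glue-[] (circ xs ∷ G) = cong₂ _∷_ (cong circ (List.concatMap-pure xs)) (glue-[] G)

hasAdjs-resp-↭ : ∀ {G X Y} → G hasAdjs X → X ↭ Y → G hasAdjs Y
hasAdjs-resp-↭ G∼X X↭Y = ↭-trans G∼X (canon-↭ X↭Y)

glue-rightExt : ∀ {G} a b rest → Unique (extremities (entries G)) → G hasAdjs (adj ⟨ a ⟩ b ∷ rest) →
                glue [ rightExt a ] G hasAdjs (adj ⟨ a ⟩ ⟨ barEntry a ⟩ ∷ adj ⟨ barEntry a ⟩ b ∷ rest)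
glue-rightExt {G} a b rest uniq G∼ = begin
  canon (adjs (glue Q G))                                       ↭⟨ hasAdjs-glue {G} X G∼ ⟩
  canon (map shiftAdj X ++ newAdjsAt (rightExt a ∷ W))          ≡⟨ cong canon glued ⟩
  canon ((rightExt (barEntry a) , leftPt b) ∷ rest ++ [ adj ⟨ a ⟩ ⟨ barEntry a ⟩ ])
    ↭⟨ canon-↭ (prep (rightExt (barEntry a) , leftPt b) (++-comm rest [ adj ⟨ a ⟩ ⟨ barEntry a ⟩ ])) ⟩
  canon ((rightExt (barEntry a) , leftPt b) ∷ adj ⟨ a ⟩ ⟨ barEntry a ⟩ ∷ rest)
    ↭⟨ canon-↭ (swap (rightExt (barEntry a) , leftPt b) (adj ⟨ a ⟩ ⟨ barEntry a ⟩)
                     (↭-refl {x = rest})) ⟩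
  canon (adj ⟨ a ⟩ ⟨ barEntry a ⟩ ∷ adj ⟨ barEntry a ⟩ b ∷ rest) ∎
  where
    open PermutationReasoning
    Q = [ rightExt a ]
    open Glue Q
      using (shiftAdj; shift-∈; shift-proper-∉; newAdjsAt; hasAdjs-glue; map-shiftAdj-outside; newAdjsAt-outside)
    X = adj ⟨ a ⟩ b ∷ rest
    W = proper (leftPt b) ++ adjPoints rest
    W∌a : ∀ {p} → p ∈ W → p ∉ Q
    W∌a p∈W (here refl) =
      Unique[x∷xs]⇒x∉xs (Unique-resp-↭ (hasAdjs⇒extremities-↭ {G} X G∼) uniq) p∈W
    glued : map shiftAdj X ++ newAdjsAt (rightExt a ∷ W)
            ≡ (rightExt (barEntry a) , leftPt b) ∷ rest ++ [ adj ⟨ a ⟩ ⟨ barEntry a ⟩ ]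
    glued rewrite shift-∈ {rightExt a} (here refl) | Dec.dec-true (rightExt a ∈? Q) (here refl)
                | shift-proper-∉ (leftPt b) (W∌a ∘′ ∈-++⁺ˡ)
                | map-shiftAdj-outside rest (W∌a ∘′ ∈-++⁺ʳ (proper (leftPt b)))
                | newAdjsAt-outside W W∌a = refl

record Admissible (P : List Point) (G : Genome) : Set where
  field
    ⊆-extremities : ∀ {p} → p ∈ P → p ∈ extremities (entries G)
    barPt-∉       : ∀ {p} → p ∈ P → barPt p ∉ extremities (entries G)
    markersUnique : MarkersUnique P
open Admissible

Admissible-[] : ∀ {G} → Admissible [] G
Admissible-[] = record { ⊆-extremities = λ () ; barPt-∉ = λ () ; markersUnique = λ () }

Admissible-resp-↭ : ∀ {P G H} → extremities (entries G) ↭ extremities (entries H) →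
                    Admissible P G → Admissible P H
Admissible-resp-↭ G↭H adm = record
  { ⊆-extremities = ∈-resp-↭ G↭H ∘′ ⊆-extremities adm
  ; barPt-∉       = λ p∈P → barPt-∉ adm p∈P ∘′ ∈-resp-↭ (↭-sym G↭H)
  ; markersUnique = markersUnique adm
  }

Admissible-barPt-∉ : ∀ {P G p} → Admissible P G → p ∈ extremities (entries G) → barPt p ∉ P
Admissible-barPt-∉ {G = G} {p} adm p∈G bar∈P =
  barPt-∉ adm bar∈P (subst (_∈ extremities (entries G)) (sym (barPt-involutive p)) p∈G)

Admissible⇒ShiftInvertible : ∀ {P G} → Admissible P G → Glue.ShiftInvertibleOn P (extremities (entries G))
Admissible⇒ShiftInvertible     adm {tel}       _   = refl
Admissible⇒ShiftInvertible {P} adm {ext n b h} p∈G with ext n b h ∈? P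
... | yes p∈P rewrite not-involutive b | Dec.dec-true (ext n b h ∈? P) p∈P = refl
... | no _    rewrite Dec.dec-false (ext n (not b) h ∈? P) (Admissible-barPt-∉ adm p∈G) = refl

record Insertion (a : Entry) (G G' : Genome) : Set where
  field
    next   : Elt
    rest   : List Adj
    before : G hasAdjs (adj ⟨ a ⟩ next ∷ rest)
    after  : G' hasAdjs (adj ⟨ a ⟩ ⟨ barEntry a ⟩ ∷ adj ⟨ barEntry a ⟩ next ∷ rest)
    fresh  : ∀ {h} → ext (name a) (not (barred a)) h ∉ extremities (entries G)

module _ {a G G'} (ins : Insertion a G G') where
  open Insertion ins

  private
    ā = barEntry a
    W = proper (leftPt next) ++ adjPoints rest
    extremities-before = hasAdjs⇒extremities-↭ {G} (adj ⟨ a ⟩ next ∷ rest) before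

  extremities-after : extremities (entries G') ↭ leftExt ā ∷ rightExt ā ∷ extremities (entries G)
  extremities-after = begin
    extremities (entries G')
      ↭⟨ hasAdjs⇒extremities-↭ {G'} (adj ⟨ a ⟩ ⟨ ā ⟩ ∷ adj ⟨ ā ⟩ next ∷ rest) after ⟩
    rightExt a ∷ leftExt ā ∷ rightExt ā ∷ W
      ↭⟨ shifts [ rightExt a ] (leftExt ā ∷ rightExt ā ∷ []) ⟩
    leftExt ā ∷ rightExt ā ∷ rightExt a ∷ W
      ↭⟨ prep (leftExt ā) (prep (rightExt ā) extremities-before) ⟨
    leftExt ā ∷ rightExt ā ∷ extremities (entries G) ∎
    where open PermutationReasoning

  Unique-after : Unique (extremities (entries G)) → Unique (extremities (entries G'))
  Unique-after uniq = Unique-resp-↭ (↭-sym extremities-after)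
    ((leftExt≢rightExt ā ∷ ¬Any⇒All¬ _ fresh) ∷ ¬Any⇒All¬ _ fresh ∷ uniq)

  rightExt-before : rightExt a ∈ extremities (entries G)
  rightExt-before = ∈-resp-↭ (↭-sym extremities-before) (here refl)

  markerPoints-after : ∀ b h → ext (name a) b h ∈ extremities (entries G')
  markerPoints-after b h = ⊆after (markerPoints a b h)
    where
      ⊆after : ∀ {p} → p ∈ leftExt a ∷ rightExt a ∷ leftExt ā ∷ rightExt ā ∷ [] →
               p ∈ extremities (entries G')
      ⊆after (here refl)                         =
        ∈-resp-↭ (↭-sym extremities-after) (there (there (extremities-otherEnd (entries G) rightExt-before)))
      ⊆after (there (here refl))                 = ∈-resp-↭ (↭-sym extremities-after) (there (there rightExt-before))
      ⊆after (there (there (here refl)))         = ∈-resp-↭ (↭-sym extremities-after) (here refl)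
      ⊆after (there (there (there (here refl)))) = ∈-resp-↭ (↭-sym extremities-after) (there (here refl))

  -- All four extremities with the marker of a lie in G', so no admissible site of G' has it.
  markerOf-∉-admissible : ∀ {P'} → Admissible P' G' → ∀ {q} → q ∈ P' → markerOf q ≢ name a
  markerOf-∉-admissible adm {tel}       q∈P' _    = tel∉extremities (entries G') (⊆-extremities adm q∈P')
  markerOf-∉-admissible adm {ext n b h} q∈P' refl = barPt-∉ adm q∈P' (markerPoints-after (not b) h)

  Admissible-before : ∀ {P'} → Admissible P' G' → Admissible (rightExt a ∷ P') G
  Admissible-before {P'} adm = record { ⊆-extremities = ⊆G ; barPt-∉ = bar∉G ; markersUnique = unique }
    where
      noMarker = markerOf-∉-admissible adm

      ⊆G : ∀ {q} → q ∈ rightExt a ∷ P' → q ∈ extremities (entries G)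
      ⊆G (here refl) = rightExt-before
      ⊆G (there q∈P') with ∈-resp-↭ extremities-after (⊆-extremities adm q∈P')
      ... | here refl         = ⊥-elim (noMarker q∈P' refl)
      ... | there (here refl) = ⊥-elim (noMarker q∈P' refl)
      ... | there (there q∈G) = q∈G

      bar∉G : ∀ {q} → q ∈ rightExt a ∷ P' → barPt q ∉ extremities (entries G)
      bar∉G (here refl)  = fresh
      bar∉G (there q∈P') = barPt-∉ adm q∈P' ∘′ ∈-resp-↭ (↭-sym extremities-after) ∘′ there ∘′ there

      unique : MarkersUnique (rightExt a ∷ P')
      unique (here refl)  (here refl)  _  = refl
      unique (here refl)  (there q∈P') eq = ⊥-elim (noMarker q∈P' (sym eq))
      unique (there p∈P') (here refl)  eq = ⊥-elim (noMarker p∈P' eq)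
      unique (there p∈P') (there q∈P') eq = markersUnique adm p∈P' q∈P' eq

  glue-before : ∀ {P'} → Unique (extremities (entries G)) → Admissible P' G' →
                glue (rightExt a ∷ P') G ≈ glue P' G'
  glue-before {P'} uniq adm = subst (_≈ glue P' G') (sym (glue-++ [ rightExt a ] P' unique disjoint G))
    (Glue.glue-resp-≈ P' {glue [ rightExt a ] G} {G'}
      (↭-trans (glue-rightExt {G} a next rest uniq before) (↭-sym after)))
    where
      unique : MarkersUnique [ rightExt a ]
      unique (here refl) (here refl) _ = refl
      disjoint : MarkersDisjoint [ rightExt a ] P'
      disjoint (here refl) q∈P' eq = markerOf-∉-admissible adm q∈P' (sym eq)

-- The duplicating half of a BD operation, absorbed into the gluing sites.
record Duplication (G G' : Genome) : Set where
  field
    sites      : List Point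
    unique     : Unique (extremities (entries G'))
    admissible : ∀ {P} → Admissible P G' → Admissible (sites ++ P) G
    glue-≈     : ∀ {P} → Admissible P G' → glue (sites ++ P) G ≈ glue P G'

Duplication-refl : ∀ {G} → Unique (extremities (entries G)) → Duplication G G
Duplication-refl uniq =
  record { sites = [] ; unique = uniq ; admissible = λ adm → adm ; glue-≈ = λ _ → ↭-refl }

Duplication-∘ : ∀ {G G₁ G'} → Duplication G G₁ → Duplication G₁ G' → Duplication G G'
Duplication-∘ {G} {G' = G'} d₁ d₂ = record
  { sites      = D₁.sites ++ D₂.sites
  ; unique     = D₂.unique
  ; admissible = λ {P} adm → subst (λ Q → Admissible Q G) (sym (List.++-assoc D₁.sites D₂.sites P))
                                   (D₁.admissible (D₂.admissible adm))
  ; glue-≈     = λ {P} adm → subst (λ Q → glue Q G ≈ glue P G') (sym (List.++-assoc D₁.sites D₂.sites P))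
                                   (↭-trans (D₁.glue-≈ (D₂.admissible adm)) (D₂.glue-≈ adm))
  }
  where
    module D₁ = Duplication d₁
    module D₂ = Duplication d₂

Insertion⇒Duplication : ∀ {a G G'} → Insertion a G G' → Unique (extremities (entries G)) → Duplication G G'
Insertion⇒Duplication ins uniq = record
  { sites      = [ rightExt _ ]
  ; unique     = Unique-after ins uniq
  ; admissible = Admissible-before ins
  ; glue-≈     = glue-before ins uniq
  }

BD1⇒Duplication : ∀ {Step G H} → Unique (extremities (entries G)) → BD1 Step G H →
                  ∃[ G' ] (Duplication G G' × Step G' H)
BD1⇒Duplication {G = G} uniq (bd1 a b c d rest G' ā∉G G∼ G'∼ _ op) = G' , Insertion⇒Duplication ins uniq , op
  where
    -- The adjacencies of H (the ignored argument) are already determined by the step G' → H.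
    ins : Insertion a G G'
    ins = record
      { next = b ; rest = adj c d ∷ rest ; before = G∼ ; after = G'∼
      ; fresh = ā∉G ∘′ extremities⇒∈ (entries G)
      }

-- A 2-breakpoint duplication inserts ā after a, then c̄ after c.
BD2⇒Duplication : ∀ {Step G H} → Unique (extremities (entries G)) → BD2 Step G H →
                  ∃[ G' ] (Duplication G G' × Step G' H)
BD2⇒Duplication {G = G} uniq (bd2 a b c d rest G' ā∉G c̄∉G a≢c G∼ G'∼ _ op) =
  G' , Duplication-∘ (Insertion⇒Duplication ins₁ uniq) (Insertion⇒Duplication ins₂ (Unique-after ins₁ uniq)) ,
  op
  where
    ā = barEntry a
    c̄ = barEntry c
    G₁ = glue [ rightExt a ] G
    aā = adj ⟨ a ⟩ ⟨ ā ⟩ ∷ adj ⟨ ā ⟩ b ∷ []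

    ins₁ : Insertion a G G₁
    ins₁ = record
      { next = b ; rest = adj ⟨ c ⟩ d ∷ rest ; before = G∼
      ; after = glue-rightExt {G} a b (adj ⟨ c ⟩ d ∷ rest) uniq G∼
      ; fresh = ā∉G ∘′ extremities⇒∈ (entries G)
      }

    key≢ : ∀ {h h'} → ext (name c) (not (barred c)) h ≢ ext (name a) (not (barred a)) h'
    key≢ eq with ext-injective eq
    ... | n≡ , b≡ , _ = a≢c (sym (cong₂ _,_ n≡ (not-injective b≡)))

    c̄∉G₁ : ∀ {h} → ext (name c) (not (barred c)) h ∉ extremities (entries G₁)
    c̄∉G₁ p∈G₁ with ∈-resp-↭ (extremities-after ins₁) p∈G₁
    ... | here eq           = key≢ eq
    ... | there (here eq)   = key≢ eq
    ... | there (there p∈G) = c̄∉G (extremities⇒∈ (entries G) p∈G)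

    ins₂ : Insertion c G₁ G'
    ins₂ = record
      { next = d ; rest = adj ⟨ a ⟩ ⟨ ā ⟩ ∷ adj ⟨ ā ⟩ b ∷ rest
      ; before = hasAdjs-resp-↭ {G₁} (Insertion.after ins₁) (shifts aā [ adj ⟨ c ⟩ d ] {rest})
      ; after  = hasAdjs-resp-↭ {G'} G'∼ (shifts aā (adj ⟨ c ⟩ ⟨ c̄ ⟩ ∷ adj ⟨ c̄ ⟩ d ∷ []) {rest})
      ; fresh = c̄∉G₁
      }

BDStep⇒Duplication : ∀ {Step G H} → Unique (extremities (entries G)) → BDStep Step G H →
                     ∃[ G' ] (Duplication G G' × Step G' H)
BDStep⇒Duplication uniq (inj₁ op)        = _ , Duplication-refl uniq , op
BDStep⇒Duplication uniq (inj₂ (inj₁ bd)) = BD1⇒Duplication uniq bd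
BDStep⇒Duplication uniq (inj₂ (inj₂ bd)) = BD2⇒Duplication uniq bd

lift-scenario : ∀ m {n G B} → Unique (extremities (entries G)) → Scenario (BDStep (Op m)) n G B →
                ∃[ P ] (Admissible P G × Scenario (Op m) n (glue P G) B)
lift-scenario m {G = G} {B} uniq (done G≈B) = [] , Admissible-[] , done (subst (_≈ B) (sym (glue-[] G)) G≈B)
lift-scenario m uniq (step bd sc) with BDStep⇒Duplication uniq bd
... | G' , dup , op with lift-scenario m (Unique-resp-↭ (Op-extremities m op) (Duplication.unique dup)) sc
... | P , adm , sc' = Duplication.sites dup ++ P , Duplication.admissible dup adm' ,
      step (Op-respˡ-≈ m (Duplication.glue-≈ dup adm') (Glue.glue-Op P m (Admissible⇒ShiftInvertible adm') op))
           sc'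
  where adm' = Admissible-resp-↭ (↭-sym (Op-extremities m op)) adm

adj-∈-canon : ∀ {e y xs} → adj ⟨ e ⟩ y ∈ xs → cadj (adj ⟨ e ⟩ y) ∈ canon xs
adj-∈-canon {xs = xs} a∈xs rewrite canon≡concatMap xs = ∈-concatMap⁺′ canon₁ a∈xs (here refl)

copiesAdjacent : ∀ e → barred e ≡ false → ∀ {C} →
  cadj (adj ⟨ barEntry e ⟩ ⟨ e ⟩) ∈ C ⊎ cadj (adj ⟨ e ⟩ ⟨ barEntry e ⟩) ∈ C →
  cadj (adj ⟨ mkEntry true (name e) false ⟩ ⟨ mkEntry true (name e) true ⟩) ∈ C
  ⊎ cadj (adj ⟨ mkEntry true (name e) true ⟩ ⟨ mkEntry true (name e) false ⟩) ∈ C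
copiesAdjacent (mkEntry true  n _) refl = Sum.swap
copiesAdjacent (mkEntry false n _) refl {C} =
  Sum.map (subst (_∈ C) (cadj-comm (ext n true false) (ext n false true)))
          (subst (_∈ C) (cadj-comm (ext n false false) (ext n true true)))

module _ {P A} (adm : Admissible P A) (uniqNames : Unique (map name (entries A)))
         (unbarred : All (λ e → barred e ≡ false) (entries A)) where
  open Glue P hiding (glue)

  private
    D = glue P A

    ∈-glue⁻ : ∀ {e'} → e' ∈ entries D → ∃[ e ] (e ∈ entries A × e' ∈ glueEntry e)
    ∈-glue⁻ e'∈D = find (∈-concatMap⁻ glueEntry (subst (_ ∈_) (entries-glue A) e'∈D))

    ∈-glue⁺ : ∀ {e e'} → e ∈ entries A → e' ∈ glueEntry e → e' ∈ entries D
    ∈-glue⁺ e∈A e'∈e = subst (_ ∈_) (sym (entries-glue A)) (∈-concatMap⁺′ glueEntry e∈A e'∈e)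

    notBoth : ∀ {e} → e ∈ entries A → ¬ (leftExt e ∈ P × rightExt e ∈ P)
    notBoth {e} _ (l , r) = leftExt≢rightExt e (markersUnique adm l r refl)

    hasCopy : ∀ {e'} → e' ∈ entries D → Occurs (name e') false D
    hasCopy e'∈D with ∈-glue⁻ e'∈D
    ... | e , e∈A , e'∈e =
      e , ∈-glue⁺ e∈A (∈-glueEntry e) , sym (name-glueEntry e e'∈e) , All.lookup unbarred e∈A

    innerAdjs⊆adjs : ∀ {e a} → e ∈ entries A → a ∈ innerAdjs e → a ∈ adjs D
    innerAdjs⊆adjs {e} e∈A a∈e = ∈-resp-↭ (↭-sym (adjs-glue A))
      (∈-++⁺ʳ (map shiftAdj (adjs A)) (∈-concatMap⁺′ innerAdjs e∈A a∈e))

  glue-Dedoubled : Dedoubled D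
  glue-Dedoubled = (keysUnique , All.tabulate (λ e'∈D _ → hasCopy e'∈D)) , copiesAdjacentInD
    where
      keysUnique : Unique (map key (entries D))
      keysUnique = subst (λ es → Unique (map key es)) (sym (entries-glue A))
                         (keys-glue-unique (entries A) unbarred uniqNames notBoth)

      copiesAdjacentInD : ∀ n → Occurs n false D → Occurs n true D →
        HasAdj D ⟨ mkEntry true n false ⟩ ⟨ mkEntry true n true ⟩
        ⊎ HasAdj D ⟨ mkEntry true n true ⟩ ⟨ mkEntry true n false ⟩
      copiesAdjacentInD _ _ (e' , e'∈D , refl , e'-barred) with ∈-glue⁻ e'∈D
      ... | e , e∈A , e'∈e with glueEntry-∈ e e'∈e
      ... | inj₁ refl = ⊥-elim (false≢true (trans (sym (All.lookup unbarred e∈A)) e'-barred))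
        where false≢true : false ≢ true
              false≢true ()
      ... | inj₂ (refl , inner) = copiesAdjacent e (All.lookup unbarred e∈A)
        (Sum.map (adj-∈-canon ∘′ innerAdjs⊆adjs e∈A) (adj-∈-canon ∘′ innerAdjs⊆adjs e∈A) inner)

proposition1 : (m : Model) (A B : Genome) (n : ℕ) →
    NonDuplicated A → Duplicated B →
    Scenario (BDStep (Op m)) n A B →
    Σ Genome (λ D → Dedoubled D × reduction D ≈ A × Scenario (Op m) n D B)
proposition1 m A B n (uniqNames , unbarred) _ sc
  with lift-scenario m (Unique-extremities (entries A) uniqNames) sc
... | P , adm , sc' = glue P A , glue-Dedoubled adm uniqNames unbarred ,
                      subst (_≈ A) (sym (Glue.reduction-glue P A unbarred)) ↭-refl , sc'
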